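{- Let $n\ge 2$ and let $\mathcal{S}$ be a finite super-atomic lattice in $\mathcal{L}(n)$, represented as a family of subsets of $\{1,\dots,n\}$ ordered by inclusion. Let $\mathcal{S}_0=\{\emptyset\}$ and $\mathcal{S}_1=\{\{1\},\dots,\{n\}\}$. Then: (A1) $\{\emptyset,\{1\},\{2\},\dots,\{n\},\{1,2,\dots,n\}\}\subseteq\mathcal{S}$; (A2) if $S\in\mathcal{S}\setminus(\mathcal{S}_0\cup\mathcal{S}_1)$, then there exist $\{i\},\{j\}\in\mathcal{S}_1$ with $S=\{i\}\vee\{j\}$ in $\mathcal{S}$; moreover, for $r\in S$, $S\setminus\{r\}\in\mathcal{S}$ if and only if $r\in\{i,j\}$; (A3) if $S_1=\{u\}\vee\{v\}$ and $S_2=\{k\}\vee\{h\}$ in $\mathcal{S}$ and $S_1$, $S_2$ are incomparable, then $\{u,v\}\not\subseteq S_2$ and $\{k,h\}\not\subseteq S_1$.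
   Context: $\mathcal{L}(n)$ denotes the set of finite atomic lattices with $n$ atoms labeled $1,\dots,n$; each such lattice is represented as a family $\mathcal{S}$ of subsets of $\{1,\dots,n\}$, closed under intersection, containing $\emptyset$, $\{1,\dots,n\}$ and all singletons $\{i\}$, ordered by inclusion (an element corresponds to its set of atoms below it; joins in $\mathcal{S}$ are the smallest members of $\mathcal{S}$ containing the union). For an element $p$ of a finite atomic lattice $P$ let $\mathrm{supp}(p)$ be the set of atoms below $p$ and $B_p=\{T\subseteq\mathrm{supp}(p): \bigvee_{b\in T}b=p\}$. A finite atomic lattice $P$ is super-atomic if for every $p\in P$ that is neither the bottom element nor an atom, and every $T\in B_p$, there exist exactly two elements $a,b\in T$ with $a\vee b=p$. -}

module Defs where

open import Data.Nat using (ℕ)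
open import Data.Fin using (Fin)
open import Data.Fin.Subset using (Subset; _∈_; _⊆_; _∪_; _∩_; ⁅_⁆; ⊥; ⊤)
open import Data.List using (List)
open import Data.List.Membership.Propositional using () renaming (_∈_ to _∈ₗ_)
open import Data.Product using (Σ; _×_; ∃; ∃-syntax)
open import Data.Sum using (_⊎_)
open import Relation.Nullary using (¬_)
open import Relation.Binary.PropositionalEquality using (_≡_; _≢_)

Family : ℕ → Set
Family n = List (Subset n)

_∈𝓢_ : ∀ {n} → Subset n → Family n → Set
S ∈𝓢 𝓢 = S ∈ₗ 𝓢

infix 4 _∈𝓢_

IsLatticeL : ∀ {n} → Family n → Set
IsLatticeL {n} 𝓢 =
  (⊥ ∈𝓢 𝓢) × (⊤ ∈𝓢 𝓢) × (∀ (i : Fin n) → ⁅ i ⁆ ∈𝓢 𝓢)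
  × (∀ A B → A ∈𝓢 𝓢 → B ∈𝓢 𝓢 → (A ∩ B) ∈𝓢 𝓢)

IsJoinOf : ∀ {n} → Family n → Subset n → Subset n → Set
IsJoinOf 𝓢 T J = (J ∈𝓢 𝓢) × (T ⊆ J) × (∀ K → K ∈𝓢 𝓢 → T ⊆ K → J ⊆ K)

IsJoin : ∀ {n} → Family n → Subset n → Subset n → Subset n → Set
IsJoin 𝓢 A B J = IsJoinOf 𝓢 (A ∪ B) J

IsAtom : ∀ {n} → Subset n → Set
IsAtom {n} S = ∃[ i ] S ≡ ⁅ i ⁆

-- Super-atomic: for every p ∈ 𝓢 other than the bottom ∅ and the atoms,
-- and every T ∈ B_p (T ⊆ supp(p) = p with ⋁T = p), there is exactly one
-- pair of two distinct elements a, b ∈ T with a ∨ b = p.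
SuperAtomic : ∀ {n} → Family n → Set
SuperAtomic {n} 𝓢 =
  ∀ (p : Subset n) → p ∈𝓢 𝓢 → p ≢ ⊥ → ¬ IsAtom p →
  ∀ (T : Subset n) → T ⊆ p → IsJoinOf 𝓢 T p →
  Σ (Fin n) λ a → Σ (Fin n) λ b →
    a ≢ b × a ∈ T × b ∈ T × IsJoin 𝓢 ⁅ a ⁆ ⁅ b ⁆ p ×
    (∀ (c d : Fin n) → c ≢ d → c ∈ T → d ∈ T → IsJoin 𝓢 ⁅ c ⁆ ⁅ d ⁆ p →
       (c ≡ a × d ≡ b) ⊎ (c ≡ b × d ≡ a))

-- Taking T = S in super-atomicity gives, for every non-trivial S ∈ 𝓢, a pair
-- {i, j} with S = i ∨ j, and it is the only such pair. If S - r ∈ 𝓢 for some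
-- r ∉ {i, j}, then S - r is an upper bound of i and j strictly below S, which is
-- impossible. If S - r ∉ 𝓢, then every member of 𝓢 containing S - r contains S
-- (otherwise intersecting it with S would give S - r), so S is the join of S - r;
-- super-atomicity then produces a generating pair inside S - r, which by
-- uniqueness is {i, j}, hence r ∉ {i, j}. Part (A3) is the minimality of joins.
module Submission where

open import Defs
open import Data.Nat using (ℕ; _≤_)
open import Data.Fin using (Fin)
open import Data.Fin.Subset using (Subset; _∈_; _⊆_; _-_; ⁅_⁆; ⊥; ⊤)
open import Data.Product using (Σ; _×_; ∃; ∃-syntax)
open import Data.Sum using (_⊎_)
open import Relation.Nullary using (¬_)
open import Relation.Binary.PropositionalEquality using (_≡_; _≢_)
open import Function.Bundles using (_⇔_)

open import Data.Bool.Properties using () renaming (_≟_ to _≟ᵇ_)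
open import Data.Empty using (⊥-elim)
open import Data.Fin.Properties using (_≟_)
open import Data.Fin.Subset using (_─_; _∩_; _∪_; _∉_; inside; outside)
open import Data.Fin.Subset.Properties
  using (x∈⁅x⁆; x∈⁅y⁆⇒x≡y; x∈p∪q⁻; p⊆p∪q; q⊆p∪q; x∈p∩q⁺; x∈p∩q⁻; ⊆-antisym; p─q⊆p; x∈p∧x≢y⇒x∈p-y; _∈?_)
open import Data.Product using (_,_; proj₁; proj₂)
open import Data.Sum using (inj₁; inj₂; [_,_])
open import Data.Vec using (_∷_; here; there)
open import Data.Vec.Properties using (≡-dec)
open import Function.Base using (_∘_)
open import Function.Bundles using (mk⇔)
open import Relation.Nullary using (yes; no)
open import Relation.Binary.PropositionalEquality using (refl; sym; trans; subst)

private
  variable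
    n : ℕ
    x y z : Fin n
    p q : Subset n

x∈p─q⇒x∉q : ∀ (p q : Subset n) → x ∈ p ─ q → x ∉ q
x∈p─q⇒x∉q (inside ∷ p) (outside ∷ q) here ()
x∈p─q⇒x∉q (_ ∷ p) (_ ∷ q) (there x∈p─q) (there x∈q) = x∈p─q⇒x∉q p q x∈p─q x∈q

x∉p-x : ∀ (p : Subset n) → x ∉ p - x
x∉p-x {x = x} p x∈p-x = x∈p─q⇒x∉q p ⁅ x ⁆ x∈p-x (x∈⁅x⁆ x)

x∈p-y⇒x≢y : ∀ (p : Subset n) → x ∈ p - y → x ≢ y
x∈p-y⇒x≢y p x∈p-x refl = x∉p-x p x∈p-x

x∈p∧y∈p⇒⁅x⁆∪⁅y⁆⊆p : x ∈ p → y ∈ p → ⁅ x ⁆ ∪ ⁅ y ⁆ ⊆ p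
x∈p∧y∈p⇒⁅x⁆∪⁅y⁆⊆p {x = x} {y = y} x∈p y∈p z∈ with x∈p∪q⁻ ⁅ x ⁆ ⁅ y ⁆ z∈
... | inj₁ z∈⁅x⁆ rewrite x∈⁅y⁆⇒x≡y x z∈⁅x⁆ = x∈p
... | inj₂ z∈⁅y⁆ rewrite x∈⁅y⁆⇒x≡y y z∈⁅y⁆ = y∈p

p-x⊆q∧x∈q⇒p⊆q : x ∈ q → p - x ⊆ q → p ⊆ q
p-x⊆q∧x∈q⇒p⊆q {x = x} x∈q p-x⊆q {z} z∈p with z ≟ x
... | yes refl = x∈q
... | no z≢x   = p-x⊆q (x∈p∧x≢y⇒x∈p-y z∈p z≢x)

p-x⊆q∧x∉q⇒q∩p≡p-x : x ∉ q → p - x ⊆ q → q ∩ p ≡ p - x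
p-x⊆q∧x∉q⇒q∩p≡p-x {x = x} {q = q} {p = p} x∉q p-x⊆q = ⊆-antisym q∩p⊆p-x p-x⊆q∩p
  where
  q∩p⊆p-x : q ∩ p ⊆ p - x
  q∩p⊆p-x z∈q∩p with x∈p∩q⁻ q p z∈q∩p
  ... | z∈q , z∈p = x∈p∧x≢y⇒x∈p-y z∈p λ { refl → x∉q z∈q }
  p-x⊆q∩p : p - x ⊆ q ∩ p
  p-x⊆q∩p z∈p-x = x∈p∩q⁺ (p-x⊆q z∈p-x , p─q⊆p p ⁅ x ⁆ z∈p-x)

member-of-equal-pairs : ∀ {a b : Fin n} → z ≡ x ⊎ z ≡ y →
                        (a ≡ x × b ≡ y) ⊎ (a ≡ y × b ≡ x) → z ≡ a ⊎ z ≡ b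
member-of-equal-pairs (inj₁ z≡x) (inj₁ (a≡x , _)) = inj₁ (trans z≡x (sym a≡x))
member-of-equal-pairs (inj₁ z≡x) (inj₂ (_ , b≡x)) = inj₂ (trans z≡x (sym b≡x))
member-of-equal-pairs (inj₂ z≡y) (inj₁ (_ , b≡y)) = inj₂ (trans z≡y (sym b≡y))
member-of-equal-pairs (inj₂ z≡y) (inj₂ (a≡y , _)) = inj₁ (trans z≡y (sym a≡y))

IntersectionClosed : Family n → Set
IntersectionClosed 𝓢 = ∀ A B → A ∈𝓢 𝓢 → B ∈𝓢 𝓢 → (A ∩ B) ∈𝓢 𝓢

UniqueGeneratingPair : Family n → Subset n → Fin n → Fin n → Set
UniqueGeneratingPair 𝓢 S i j =
  IsJoin 𝓢 ⁅ i ⁆ ⁅ j ⁆ S ×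
  (∀ c d → c ≢ d → c ∈ S → d ∈ S → IsJoin 𝓢 ⁅ c ⁆ ⁅ d ⁆ S →
     (c ≡ i × d ≡ j) ⊎ (c ≡ j × d ≡ i))

module _ {𝓢 : Family n} where

  open import Data.List.Membership.DecPropositional (≡-dec {n = n} _≟ᵇ_) using ()
    renaming (_∈?_ to _∈𝓢?_)

  isJoinOf-refl : ∀ {S} → S ∈𝓢 𝓢 → IsJoinOf 𝓢 S S
  isJoinOf-refl S∈𝓢 = S∈𝓢 , (λ z∈S → z∈S) , λ _ _ S⊆K → S⊆K

  isJoin-⊇ : ∀ {i j S} → IsJoin 𝓢 ⁅ i ⁆ ⁅ j ⁆ S → i ∈ S × j ∈ S
  isJoin-⊇ {i} {j} (_ , ⁅i⁆∪⁅j⁆⊆S , _) =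
    ⁅i⁆∪⁅j⁆⊆S (p⊆p∪q ⁅ j ⁆ (x∈⁅x⁆ i)) , ⁅i⁆∪⁅j⁆⊆S (q⊆p∪q ⁅ i ⁆ ⁅ j ⁆ (x∈⁅x⁆ j))

  isJoin-least : ∀ {i j S K} → IsJoin 𝓢 ⁅ i ⁆ ⁅ j ⁆ S → K ∈𝓢 𝓢 → i ∈ K → j ∈ K → S ⊆ K
  isJoin-least (_ , _ , least) K∈𝓢 i∈K j∈K = least _ K∈𝓢 (x∈p∧y∈p⇒⁅x⁆∪⁅y⁆⊆p i∈K j∈K)

  isJoinOf-minus : IntersectionClosed 𝓢 → ∀ {S r} → S ∈𝓢 𝓢 → ¬ ((S - r) ∈𝓢 𝓢) →
                   IsJoinOf 𝓢 (S - r) S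
  isJoinOf-minus ∩-closed {S} {r} S∈𝓢 S-r∉𝓢 = S∈𝓢 , p─q⊆p S ⁅ r ⁆ , least
    where
    least : ∀ K → K ∈𝓢 𝓢 → S - r ⊆ K → S ⊆ K
    least K K∈𝓢 S-r⊆K with r ∈? K
    ... | yes r∈K = p-x⊆q∧x∈q⇒p⊆q r∈K S-r⊆K
    ... | no r∉K  = ⊥-elim (S-r∉𝓢 (subst (_∈𝓢 𝓢) (p-x⊆q∧x∉q⇒q∩p≡p-x r∉K S-r⊆K)
                                         (∩-closed K S K∈𝓢 S∈𝓢)))

  removable⇒generator : ∀ {i j S r} → IsJoin 𝓢 ⁅ i ⁆ ⁅ j ⁆ S → r ∈ S →
                        (S - r) ∈𝓢 𝓢 → r ≡ i ⊎ r ≡ j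
  removable⇒generator {i} {j} {S} {r} S≡i∨j r∈S S-r∈𝓢 with r ≟ i | r ≟ j
  ... | yes r≡i | _       = inj₁ r≡i
  ... | no _    | yes r≡j = inj₂ r≡j
  ... | no r≢i  | no r≢j  = ⊥-elim (x∉p-x S (S⊆S-r r∈S))
    where
    S⊆S-r : S ⊆ S - r
    S⊆S-r = isJoin-least S≡i∨j S-r∈𝓢
      (x∈p∧x≢y⇒x∈p-y (proj₁ (isJoin-⊇ S≡i∨j)) (r≢i ∘ sym))
      (x∈p∧x≢y⇒x∈p-y (proj₂ (isJoin-⊇ S≡i∨j)) (r≢j ∘ sym))

  uniqueGeneratingPair : SuperAtomic 𝓢 → ∀ {S} → S ∈𝓢 𝓢 → S ≢ ⊥ → ¬ IsAtom S →
                         ∃[ i ] ∃[ j ] UniqueGeneratingPair 𝓢 S i j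
  uniqueGeneratingPair SA {S} S∈𝓢 S≢⊥ S-nonAtom
    with SA S S∈𝓢 S≢⊥ S-nonAtom S (λ z∈S → z∈S) (isJoinOf-refl S∈𝓢)
  ... | i , j , _ , _ , _ , S≡i∨j , unique = i , j , S≡i∨j , unique

  generator⇒removable : IntersectionClosed 𝓢 → SuperAtomic 𝓢 → ∀ {S i j r} →
                        S ∈𝓢 𝓢 → S ≢ ⊥ → ¬ IsAtom S → UniqueGeneratingPair 𝓢 S i j →
                        r ≡ i ⊎ r ≡ j → (S - r) ∈𝓢 𝓢
  generator⇒removable ∩-closed SA {S} {r = r} S∈𝓢 S≢⊥ S-nonAtom (_ , unique) r∈⦃i,j⦄
    with (S - r) ∈𝓢? 𝓢
  ... | yes S-r∈𝓢 = S-r∈𝓢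
  ... | no S-r∉𝓢
    with SA S S∈𝓢 S≢⊥ S-nonAtom (S - r) (p─q⊆p S ⁅ r ⁆) (isJoinOf-minus ∩-closed S∈𝓢 S-r∉𝓢)
  ... | a , b , a≢b , a∈S-r , b∈S-r , S≡a∨b , _ =
    ⊥-elim ([ x∈p-y⇒x≢y S a∈S-r ∘ sym , x∈p-y⇒x≢y S b∈S-r ∘ sym ]
              (member-of-equal-pairs r∈⦃i,j⦄
                (unique a b a≢b (p─q⊆p S ⁅ r ⁆ a∈S-r) (p─q⊆p S ⁅ r ⁆ b∈S-r) S≡a∨b)))

  nonTrivial⇒removableExactlyAtGenerators :
    IntersectionClosed 𝓢 → SuperAtomic 𝓢 →
    ∀ S → S ∈𝓢 𝓢 → S ≢ ⊥ → ¬ IsAtom S →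
    Σ (Fin n) λ i → Σ (Fin n) λ j → IsJoin 𝓢 ⁅ i ⁆ ⁅ j ⁆ S ×
      (∀ (r : Fin n) → r ∈ S → ((S - r) ∈𝓢 𝓢) ⇔ (r ≡ i ⊎ r ≡ j))
  nonTrivial⇒removableExactlyAtGenerators ∩-closed SA S S∈𝓢 S≢⊥ S-nonAtom
    with uniqueGeneratingPair SA S∈𝓢 S≢⊥ S-nonAtom
  ... | i , j , pair@(S≡i∨j , _) = i , j , S≡i∨j , λ r r∈S →
    mk⇔ (removable⇒generator S≡i∨j r∈S)
        (generator⇒removable ∩-closed SA S∈𝓢 S≢⊥ S-nonAtom pair)

lemma4p1 : (n : ℕ) → 2 ≤ n → (𝓢 : Family n) → IsLatticeL 𝓢 → SuperAtomic 𝓢 →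
    ((⊥ ∈𝓢 𝓢) × (∀ (i : Fin n) → ⁅ i ⁆ ∈𝓢 𝓢) × (⊤ ∈𝓢 𝓢))
    × (∀ (S : Subset n) → S ∈𝓢 𝓢 → S ≢ ⊥ → ¬ IsAtom S →
         Σ (Fin n) λ i → Σ (Fin n) λ j → IsJoin 𝓢 ⁅ i ⁆ ⁅ j ⁆ S ×
           (∀ (r : Fin n) → r ∈ S → ((S - r) ∈𝓢 𝓢) ⇔ (r ≡ i ⊎ r ≡ j)))
    × (∀ (S₁ S₂ : Subset n) (u v k h : Fin n) →
         IsJoin 𝓢 ⁅ u ⁆ ⁅ v ⁆ S₁ → IsJoin 𝓢 ⁅ k ⁆ ⁅ h ⁆ S₂ →
         ¬ (S₁ ⊆ S₂) → ¬ (S₂ ⊆ S₁) →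
         ¬ (u ∈ S₂ × v ∈ S₂) × ¬ (k ∈ S₁ × h ∈ S₁))
lemma4p1 n _ 𝓢 (⊥∈𝓢 , ⊤∈𝓢 , atoms∈𝓢 , ∩-closed) SA =
  (⊥∈𝓢 , atoms∈𝓢 , ⊤∈𝓢) ,
  nonTrivial⇒removableExactlyAtGenerators ∩-closed SA ,
  λ S₁ S₂ u v k h S₁≡u∨v S₂≡k∨h S₁⊈S₂ S₂⊈S₁ →
    (λ (u∈S₂ , v∈S₂) → S₁⊈S₂ (isJoin-least S₁≡u∨v (proj₁ S₂≡k∨h) u∈S₂ v∈S₂)) ,
    (λ (k∈S₁ , h∈S₁) → S₂⊈S₁ (isJoin-least S₂≡k∨h (proj₁ S₁≡u∨v) k∈S₁ h∈S₁))
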